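{- Let $n,r$ be positive integers with $d=\gcd(r,n)>1$ and $\frac nd$ odd, and let $G_r=2^r+1$. Then $$G_r^{ -1}\equiv\sum_{i=0}^{d-1}\sum_{j=0}^{\frac nd-1}a_{i,j}2^{i-jr}\pmod{2^n-1},$$ where $(a_{i,j})$ is the $d\times\frac nd$ matrix whose rows $0,\dots,d-2$ all equal $(0,0,1,0,1,0,\dots,0,1)$ (i.e. $a_{i,0}=a_{i,1}=0$ and, for $j\ge2$, $a_{i,j}=1$ iff $j$ is even) and whose last row $d-1$ equals $(1,1,0,1,0,1,\dots,1,0)$ (i.e. $a_{d-1,0}=a_{d-1,1}=1$ and, for $j\ge2$, $a_{d-1,j}=1$ iff $j$ is odd). In particular $\mathrm{wt}(G_r^{ -1})=\frac{n-d+2}{2}$.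
   Context: $G_r^{ -1}$ denotes the least positive residue of the inverse of $G_r$ modulo $2^n-1$, and $\mathrm{wt}(m)$ is the number of ones in the binary expansion of $m$. Powers $2^{m}$ with arbitrary integer $m$ are understood modulo $2^n-1$, i.e. $2^m=2^{m\bmod n}$. -}

module Defs where

open import Data.Nat using (ℕ; zero; suc; _+_; _*_; _∸_; _^_; _%_; _/_; _≡ᵇ_; ∣_-_∣)
open import Data.Nat.Divisibility using (_∣_)
open import Data.Bool using (Bool; true; false; if_then_else_)
open import Data.List using (List; map; upTo)
open import Data.Nat.ListAction using (sum)

infix 4 _≡_[mod_]
_≡_[mod_] : ℕ → ℕ → ℕ → Set
a ≡ b [mod M ] = M ∣ ∣ a - b ∣

-- e mod n (for n = 0 we just return e; only used with n > 0).
_modN_ : ℕ → ℕ → ℕ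
e modN zero = e
e modN (suc k) = e % suc k

-- Binary weight: number of ones in the binary expansion of m.
-- (fuel f ≥ number of binary digits; m itself is enough fuel)
wtAux : ℕ → ℕ → ℕ
wtAux zero    m = 0
wtAux (suc f) m = m % 2 + wtAux f (m / 2)

wt : ℕ → ℕ
wt m = wtAux m m

G : ℕ → ℕ
G r = 2 ^ r + 1

-- The exponent  i - j r  reduced modulo n  (so 2^(i - j r) = 2^((i - j r) mod n)).
-- Since  -jr ≡ jr(n-1) (mod n)  for n > 0, we use  i + j r (n - 1)  as a
-- natural-number representative of  i - j r.
expo : (n r i j : ℕ) → ℕ
expo n r i j = (i + j * r * (n ∸ 1)) modN n

isEven : ℕ → Bool
isEven j = j % 2 ≡ᵇ 0

entry : (d i j : ℕ) → ℕ
entry d i j with i ≡ᵇ (d ∸ 1)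
... | false = if j ≡ᵇ 0 then 0 else if j ≡ᵇ 1 then 0 else (if isEven j then 1 else 0)
... | true  = if j ≡ᵇ 0 then 1 else if j ≡ᵇ 1 then 1 else (if isEven j then 0 else 1)

S : (n r d m : ℕ) → ℕ
S n r d m = sum (map (λ i → sum (map (λ j → entry d i j * 2 ^ expo n r i j) (upTo m))) (upTo d))

-- Write n = m d with m = 2q + 1 and d = gcd(r, n) ≥ 2, and compute modulo 2^n - 1,
-- where 2^x only depends on x mod n.  Multiplying by 2^r shifts each row
-- (2^(i - j r))_{j < m} cyclically by one place, so (2^r + 1) Σ_j a_j 2^(i - j r)
-- telescopes to Σ_j (a_j + a_{j+1}) 2^(i - j r).  For a type-A row this is the
-- full row sum minus 2^i, for the type-B row the full row sum plus 2^(d-1).  The full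
-- row sums add up to (2^d - 1) Y with Y = Σ_j 2^(-j r); as Y is fixed by 2^r and 2^n,
-- it is fixed by 2^d (Bézout), so they vanish, leaving 2^(d-1) - Σ_{i<d-1} 2^i = 1.
-- The exponents i - j r mod n are pairwise distinct (different mod d across rows,
-- and within a row because m is coprime to r/d), so the sum is a binary expansion
-- with (d-1) q + q + 1 < n ones; in particular it lies strictly between 0 and
-- 2^n - 1 and is therefore the unique inverse there.
module Submission where

open import Defs
open import Data.Nat
open import Data.Nat.Properties
open import Data.Nat.Tactic.RingSolver using (solve-∀)
open import Data.List using (applyUpTo; map; upTo)
open import Data.List.Properties using (map-upTo)
open import Data.Nat.ListAction using (sum)
open import Data.Product using (_,_; _×_; proj₁; proj₂; ∃)
open import Data.Empty using (⊥-elim)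
open import Data.Bool using (true; false; T; if_then_else_)
open import Data.Unit using (tt)
open import Relation.Nullary using (yes; no)
open import Data.Nat.GCD using (gcd; gcd-GCD; GCD; GCD-*; module Bézout)
open import Data.Nat.Coprimality using (Coprime; coprime-divisor; GCD≡1⇒coprime)
import Data.Nat.Coprimality as Coprimality
open import Data.Sum using (inj₁; inj₂)
open import Relation.Binary.Bundles using (Setoid)
open import Relation.Binary.Structures using (IsEquivalence)
import Relation.Binary.Reasoning.Setoid
open import Relation.Binary.PropositionalEquality
open import Data.Nat.DivMod
  using ([m+kn]%n≡m%n; m≡m%n+[m/n]*n; m<n⇒m%n≡m; m<n⇒m/n≡0; m*n/n≡m; m/n<m; +-distrib-/-∣ʳ; m%n<n; %-remove-+ʳ)
open import Data.Nat.Divisibility using (_∣_; divides; quotient; m∣n⇒n≡quotient*m; ∣⇒≤; ∣m+n∣m⇒∣n; *-cancelʳ-∣)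

∑ : ℕ → (ℕ → ℕ) → ℕ
∑ zero    f = 0
∑ (suc k) f = f 0 + ∑ k (λ j → f (suc j))

syntax ∑ k (λ j → e) = ∑[ j < k ] e

sum-map-upTo : ∀ (f : ℕ → ℕ) k → sum (map f (upTo k)) ≡ ∑ k f
sum-map-upTo f k = trans (cong sum (map-upTo f k)) (sum-applyUpTo f k)
  where
  sum-applyUpTo : ∀ (f : ℕ → ℕ) k → sum (applyUpTo f k) ≡ ∑ k f
  sum-applyUpTo f zero    = refl
  sum-applyUpTo f (suc k) = cong (f 0 +_) (sum-applyUpTo (λ j → f (suc j)) k)

∑-cong : ∀ {f g : ℕ → ℕ} k → (∀ j → j < k → f j ≡ g j) → ∑ k f ≡ ∑ k g
∑-cong zero    eq = refl
∑-cong (suc k) eq = cong₂ _+_ (eq 0 z<s) (∑-cong k (λ j j<k → eq (suc j) (s≤s j<k)))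

∑-snoc : ∀ k (f : ℕ → ℕ) → ∑ (suc k) f ≡ ∑ k f + f k
∑-snoc zero    f = +-comm (f 0) 0
∑-snoc (suc k) f = trans (cong (f 0 +_) (∑-snoc k (λ j → f (suc j)))) (sym (+-assoc (f 0) _ _))

∑-zero : ∀ k {f : ℕ → ℕ} → (∀ j → j < k → f j ≡ 0) → ∑ k f ≡ 0
∑-zero zero    eq = refl
∑-zero (suc k) eq = cong₂ _+_ (eq 0 z<s) (∑-zero k (λ j j<k → eq (suc j) (s≤s j<k)))

∑-const : ∀ k c → ∑[ _ < k ] c ≡ k * c
∑-const zero    c = refl
∑-const (suc k) c = cong (c +_) (∑-const k c)

∑-distrib-+ : ∀ k (f g : ℕ → ℕ) → ∑[ j < k ] (f j + g j) ≡ ∑ k f + ∑ k g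
∑-distrib-+ zero    f g = refl
∑-distrib-+ (suc k) f g =
  trans (cong (f 0 + g 0 +_) (∑-distrib-+ k _ _)) (interchange (f 0) (g 0) _ _)
  where
  interchange : ∀ a b c d → a + b + (c + d) ≡ a + c + (b + d)
  interchange = solve-∀

*-distribˡ-∑ : ∀ k c (f : ℕ → ℕ) → c * ∑ k f ≡ ∑[ j < k ] (c * f j)
*-distribˡ-∑ zero    c f = *-zeroʳ c
*-distribˡ-∑ (suc k) c f = trans (*-distribˡ-+ c (f 0) _) (cong (c * f 0 +_) (*-distribˡ-∑ k c _))

*-distribʳ-∑ : ∀ k c (f : ℕ → ℕ) → ∑ k f * c ≡ ∑[ j < k ] (f j * c)
*-distribʳ-∑ k c f = trans (*-comm (∑ k f) c)
  (trans (*-distribˡ-∑ k c f) (∑-cong k (λ j _ → *-comm c (f j))))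

∑-comm : ∀ a b (F : ℕ → ℕ → ℕ) → ∑[ i < a ] ∑[ j < b ] F i j ≡ ∑[ j < b ] ∑[ i < a ] F i j
∑-comm zero    b F = sym (∑-zero b (λ _ _ → refl))
∑-comm (suc a) b F = trans (cong (∑[ j < b ] F 0 j +_) (∑-comm a b (λ i → F (suc i))))
  (sym (∑-distrib-+ b (F 0) (λ j → ∑[ i < a ] F (suc i) j)))

∑-positive : ∀ k (f : ℕ → ℕ) → 0 < ∑ k f → ∃ λ j → j < k × 0 < f j
∑-positive (suc k) f pos with f 0 in eq
... | suc _ = 0 , z<s , subst (0 <_) (sym eq) z<s
... | zero with ∑-positive k (λ j → f (suc j)) pos
...   | j , j<k , fj>0 = suc j , s≤s j<k , fj>0

∑-≤1 : ∀ k (f : ℕ → ℕ) → (∀ j → j < k → f j ≤ 1) →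
  (∀ j j′ → j < k → j′ < k → 0 < f j → 0 < f j′ → j ≡ j′) → ∑ k f ≤ 1
∑-≤1 zero    f _     _      = z≤n
∑-≤1 (suc k) f f≤1 unique with f 0 in eq
... | zero  = ∑-≤1 k (λ j → f (suc j)) (λ j j<k → f≤1 (suc j) (s≤s j<k))
                (λ j j′ j<k j′<k p p′ → suc-injective (unique _ _ (s≤s j<k) (s≤s j′<k) p p′))
... | suc x = subst (λ z → suc x + z ≤ 1) (sym rest≡0)
                (subst (_≤ 1) (trans eq (sym (+-identityʳ (suc x)))) (f≤1 0 z<s))
  where
  rest≡0 : ∑[ j < k ] f (suc j) ≡ 0
  rest≡0 = ∑-zero k λ j j<k → n≤0⇒n≡0 (≮⇒≥ λ p →
    0≢1+n (unique 0 (suc j) z<s (s≤s j<k) (subst (0 <_) (sym eq) z<s) p))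

δ : ℕ → ℕ → ℕ
δ zero    zero    = 1
δ zero    (suc _) = 0
δ (suc _) zero    = 0
δ (suc a) (suc b) = δ a b

δ≤1 : ∀ a b → δ a b ≤ 1
δ≤1 zero    zero    = ≤-refl
δ≤1 zero    (suc _) = z≤n
δ≤1 (suc _) zero    = z≤n
δ≤1 (suc a) (suc b) = δ≤1 a b

δ-positive⇒≡ : ∀ a b → 0 < δ a b → a ≡ b
δ-positive⇒≡ zero    zero    _   = refl
δ-positive⇒≡ (suc a) (suc b) pos = cong suc (δ-positive⇒≡ a b pos)

∑-δ : ∀ N e (f : ℕ → ℕ) → e < N → ∑[ k < N ] (δ e k * f k) ≡ f e
∑-δ (suc N) zero    f _   =
  trans (cong₂ _+_ (*-identityˡ (f 0)) (∑-zero N (λ _ _ → refl))) (+-identityʳ (f 0))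
∑-δ (suc N) (suc e) f e<N = ∑-δ N e (λ k → f (suc k)) (s≤s⁻¹ e<N)

-- A subtraction-free form of congruence modulo M: equivalent to  _≡_[mod_],
-- but closed under + and * without any case analysis on the order of a and b.
infix 4 _≈_[mod_]
record _≈_[mod_] (a b M : ℕ) : Set where
  constructor witness
  field
    k l      : ℕ
    equation : a + k * M ≡ b + l * M

module _ {M : ℕ} where

  ≈-reflexive : ∀ {a b} → a ≡ b → a ≈ b [mod M ]
  ≈-reflexive refl = witness 0 0 refl

  ≈-refl : ∀ {a} → a ≈ a [mod M ]
  ≈-refl = ≈-reflexive refl

  ≈-sym : ∀ {a b} → a ≈ b [mod M ] → b ≈ a [mod M ]
  ≈-sym (witness k l eq) = witness l k (sym eq)

  ≈-trans : ∀ {a b c} → a ≈ b [mod M ] → b ≈ c [mod M ] → a ≈ c [mod M ]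
  ≈-trans {a} {b} {c} (witness k l eq) (witness k′ l′ eq′) = witness (k + k′) (l′ + l) (begin
    a + (k + k′) * M     ≡⟨ shuffle a k k′ M ⟩
    (a + k * M) + k′ * M ≡⟨ cong (_+ k′ * M) eq ⟩
    (b + l * M) + k′ * M ≡⟨ swap b l k′ M ⟩
    (b + k′ * M) + l * M ≡⟨ cong (_+ l * M) eq′ ⟩
    (c + l′ * M) + l * M ≡⟨ shuffle c l′ l M ⟨
    c + (l′ + l) * M     ∎)
    where
    open ≡-Reasoning
    shuffle : ∀ x p q M → x + (p + q) * M ≡ (x + p * M) + q * M
    shuffle = solve-∀
    swap : ∀ x p q M → (x + p * M) + q * M ≡ (x + q * M) + p * M
    swap = solve-∀

  ≈-isEquivalence : IsEquivalence (λ a b → a ≈ b [mod M ])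
  ≈-isEquivalence = record { refl = ≈-refl ; sym = ≈-sym ; trans = ≈-trans }

  ≈-+ : ∀ {a b c d} → a ≈ b [mod M ] → c ≈ d [mod M ] → a + c ≈ b + d [mod M ]
  ≈-+ {a} {b} {c} {d} (witness k l eq) (witness k′ l′ eq′) = witness (k + k′) (l + l′)
    (trans (shuffle a c k k′ M) (trans (cong₂ _+_ eq eq′) (sym (shuffle b d l l′ M))))
    where
    shuffle : ∀ x y p q M → x + y + (p + q) * M ≡ (x + p * M) + (y + q * M)
    shuffle = solve-∀

  ≈-*ʳ : ∀ {a b} c → a ≈ b [mod M ] → a * c ≈ b * c [mod M ]
  ≈-*ʳ {a} {b} c (witness k l eq) = witness (k * c) (l * c)
    (trans (factor a c k M) (trans (cong (_* c) eq) (sym (factor b c l M))))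
    where
    factor : ∀ x c p M → x * c + p * c * M ≡ (x + p * M) * c
    factor = solve-∀

  ≈-*ˡ : ∀ {a b} c → a ≈ b [mod M ] → c * a ≈ c * b [mod M ]
  ≈-*ˡ {a} {b} c a≈b =
    ≈-trans (≈-reflexive (*-comm c a)) (≈-trans (≈-*ʳ c a≈b) (≈-reflexive (*-comm b c)))

  ≈-* : ∀ {a b c d} → a ≈ b [mod M ] → c ≈ d [mod M ] → a * c ≈ b * d [mod M ]
  ≈-* {b = b} {c = c} a≈b c≈d = ≈-trans (≈-*ʳ c a≈b) (≈-*ˡ b c≈d)

  ≈1⇒^≈1 : ∀ {a} q → a ≈ 1 [mod M ] → a ^ q ≈ 1 [mod M ]
  ≈1⇒^≈1 zero    a≈1 = ≈-refl
  ≈1⇒^≈1 (suc q) a≈1 = ≈-* a≈1 (≈1⇒^≈1 q a≈1)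

  ≈-∑ : ∀ k {f g : ℕ → ℕ} → (∀ j → j < k → f j ≈ g j [mod M ]) → ∑ k f ≈ ∑ k g [mod M ]
  ≈-∑ zero    f≈g = ≈-refl
  ≈-∑ (suc k) f≈g = ≈-+ (f≈g 0 z<s) (≈-∑ k (λ j j<k → f≈g (suc j) (s≤s j<k)))

  ≈-+-cancelʳ : ∀ {a b} c → a + c ≈ b + c [mod M ] → a ≈ b [mod M ]
  ≈-+-cancelʳ {a} {b} c (witness k l eq) =
    witness k l (+-cancelʳ-≡ c _ _ (trans (swap a k M c) (trans eq (sym (swap b l M c)))))
    where
    swap : ∀ x p M c → x + p * M + c ≡ x + c + p * M
    swap = solve-∀

  private
    witness-∸ : ∀ {a b k l} → l ≤ k → a + k * M ≡ b + l * M → a + (k ∸ l) * M ≡ b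
    witness-∸ {a} {b} {k} {l} l≤k eq = +-cancelʳ-≡ (l * M) _ _ (begin
      a + (k ∸ l) * M + l * M   ≡⟨ +-assoc a _ _ ⟩
      a + ((k ∸ l) * M + l * M) ≡⟨ cong (a +_) (*-distribʳ-+ M (k ∸ l) l) ⟨
      a + (k ∸ l + l) * M       ≡⟨ cong (λ x → a + x * M) (m∸n+n≡m l≤k) ⟩
      a + k * M                 ≡⟨ eq ⟩
      b + l * M                 ∎)
      where open ≡-Reasoning

  ≈⇒≡[mod] : ∀ {a b} → a ≈ b [mod M ] → a ≡ b [mod M ]
  ≈⇒≡[mod] {a} {b} (witness k l eq) with ≤-total l k
  ... | inj₁ l≤k = divides (k ∸ l)
    (trans (cong (∣ a -_∣) (sym (witness-∸ l≤k eq))) (∣m-m+n∣≡n a _))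
  ... | inj₂ k≤l = divides (l ∸ k) (trans (∣-∣-comm a b)
    (trans (cong (∣ b -_∣) (sym (witness-∸ k≤l (sym eq)))) (∣m-m+n∣≡n b _)))

  ≡[mod]⇒≈ : ∀ {a b} → a ≡ b [mod M ] → a ≈ b [mod M ]
  ≡[mod]⇒≈ {a} {b} (divides c eq) with ≤-total a b
  ... | inj₁ a≤b = witness c 0 (begin
    a + c * M     ≡⟨ cong (a +_) (trans (sym eq) (m≤n⇒∣m-n∣≡n∸m a≤b)) ⟩
    a + (b ∸ a)   ≡⟨ m+[n∸m]≡n a≤b ⟩
    b             ≡⟨ +-identityʳ b ⟨
    b + 0 * M     ∎)
    where open ≡-Reasoning
  ... | inj₂ b≤a = ≈-sym (witness c 0 (begin
    b + c * M     ≡⟨ cong (b +_) (trans (sym eq) (m≤n⇒∣n-m∣≡n∸m b≤a)) ⟩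
    b + (a ∸ b)   ≡⟨ m+[n∸m]≡n b≤a ⟩
    a             ≡⟨ +-identityʳ a ⟨
    a + 0 * M     ∎))
    where open ≡-Reasoning

  ≈-<⇒≡ : ∀ {a b} → a ≈ b [mod M ] → a < M → b < M → a ≡ b
  ≈-<⇒≡ {a} {b} (witness k l eq) a<M b<M = begin
    a               ≡⟨ m<n⇒m%n≡m a<M ⟨
    a % M           ≡⟨ [m+kn]%n≡m%n a k M ⟨
    (a + k * M) % M ≡⟨ cong (_% M) eq ⟩
    (b + l * M) % M ≡⟨ [m+kn]%n≡m%n b l M ⟩
    b % M           ≡⟨ m<n⇒m%n≡m b<M ⟩
    b               ∎
    where
    open ≡-Reasoning
    instance
      _ : NonZero M
      _ = >-nonZero (≤-<-trans z≤n a<M)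

≈-setoid : ℕ → Setoid _ _
≈-setoid M = record { isEquivalence = ≈-isEquivalence {M} }

module ≈-Reasoning (M : ℕ) = Relation.Binary.Reasoning.Setoid (≈-setoid M)

≈-inverse-unique : ∀ {M g x y} → g * x ≈ 1 [mod M ] → g * y ≈ 1 [mod M ] → x ≈ y [mod M ]
≈-inverse-unique {M} {g} {x} {y} gx≈1 gy≈1 = begin
  x           ≡⟨ *-identityʳ x ⟨
  x * 1       ≈⟨ ≈-*ˡ x gy≈1 ⟨
  x * (g * y) ≡⟨ x*[g*y]≡g*x*y x g y ⟩
  g * x * y   ≈⟨ ≈-*ʳ y gx≈1 ⟩
  1 * y       ≡⟨ *-identityˡ y ⟩
  y           ∎
  where
  open ≈-Reasoning M
  x*[g*y]≡g*x*y : ∀ x g y → x * (g * y) ≡ g * x * y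
  x*[g*y]≡g*x*y = solve-∀

module _ (n : ℕ) where

  2^n≈1 : 2 ^ n ≈ 1 [mod 2 ^ n ∸ 1 ]
  2^n≈1 = witness 0 1 (begin
    2 ^ n + 0 * (2 ^ n ∸ 1) ≡⟨ +-identityʳ (2 ^ n) ⟩
    2 ^ n                   ≡⟨ m+[n∸m]≡n (m^n>0 2 n) ⟨
    1 + (2 ^ n ∸ 1)         ≡⟨ cong (1 +_) (*-identityˡ _) ⟨
    1 + 1 * (2 ^ n ∸ 1)     ∎)
    where open ≡-Reasoning

  2^[x+qn]≈2^x : ∀ x q → 2 ^ (x + q * n) ≈ 2 ^ x [mod 2 ^ n ∸ 1 ]
  2^[x+qn]≈2^x x q = begin
    2 ^ (x + q * n)     ≡⟨ ^-distribˡ-+-* 2 x (q * n) ⟩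
    2 ^ x * 2 ^ (q * n) ≡⟨ cong (λ e → 2 ^ x * 2 ^ e) (*-comm q n) ⟩
    2 ^ x * 2 ^ (n * q) ≡⟨ cong (2 ^ x *_) (^-*-assoc 2 n q) ⟨
    2 ^ x * (2 ^ n) ^ q ≈⟨ ≈-*ˡ (2 ^ x) (≈1⇒^≈1 q 2^n≈1) ⟩
    2 ^ x * 1           ≡⟨ *-identityʳ (2 ^ x) ⟩
    2 ^ x               ∎
    where open ≈-Reasoning (2 ^ n ∸ 1)

  2^x≈2^[x%n] : .{{_ : NonZero n}} → ∀ x → 2 ^ x ≈ 2 ^ (x % n) [mod 2 ^ n ∸ 1 ]
  2^x≈2^[x%n] x = ≈-trans (≈-reflexive (cong (2 ^_) (m≡m%n+[m/n]*n x n))) (2^[x+qn]≈2^x (x % n) (x / n))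

wtAux-0 : ∀ f → wtAux f 0 ≡ 0
wtAux-0 zero    = refl
wtAux-0 (suc f) = wtAux-0 f

v≤1+f⇒v/2≤f : ∀ {v f} → v ≤ suc f → v / 2 ≤ f
v≤1+f⇒v/2≤f {zero}  _   = z≤n
v≤1+f⇒v/2≤f {suc v} v≤f = <⇒≤pred (<-≤-trans (m/n<m (suc v) 2 (s≤s (s≤s z≤n))) v≤f)

wtAux-fuel : ∀ f g v → v ≤ f → v ≤ g → wtAux f v ≡ wtAux g v
wtAux-fuel zero    g       .zero z≤n _   = sym (wtAux-0 g)
wtAux-fuel (suc f) zero    .zero _   z≤n = wtAux-0 (suc f)
wtAux-fuel (suc f) (suc g) v     v≤f v≤g =
  cong (v % 2 +_) (wtAux-fuel f g (v / 2) (v≤1+f⇒v/2≤f v≤f) (v≤1+f⇒v/2≤f v≤g))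

wt-suc : ∀ v → wt (suc v) ≡ suc v % 2 + wt (suc v / 2)
wt-suc v = cong (suc v % 2 +_) (wtAux-fuel v (suc v / 2) (suc v / 2) (v≤1+f⇒v/2≤f ≤-refl) ≤-refl)

wt-digit-of-suc : ∀ {b w v} → b < 2 → b + w * 2 ≡ suc v → wt (suc v) ≡ b + wt w
wt-digit-of-suc {b} {w} {v} b<2 eq = begin
  wt (suc v)                               ≡⟨ wt-suc v ⟩
  suc v % 2 + wt (suc v / 2)               ≡⟨ cong (λ c → c % 2 + wt (c / 2)) eq ⟨
  (b + w * 2) % 2 + wt ((b + w * 2) / 2)   ≡⟨ cong₂ (λ x y → x + wt y) mod2 div2 ⟩
  b + wt w                                 ∎
  where
  open ≡-Reasoning
  mod2 : (b + w * 2) % 2 ≡ b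
  mod2 = trans ([m+kn]%n≡m%n b w 2) (m<n⇒m%n≡m b<2)
  div2 : (b + w * 2) / 2 ≡ w
  div2 = trans (+-distrib-/-∣ʳ b (divides w refl)) (cong₂ _+_ (m<n⇒m/n≡0 b<2) (m*n/n≡m w 2))

wt-digit : ∀ b w → b < 2 → wt (b + w * 2) ≡ b + wt w
wt-digit zero          zero    _   = refl
wt-digit zero          (suc w) b<2 = wt-digit-of-suc {0} {suc w} b<2 refl
wt-digit (suc zero)    w       b<2 = wt-digit-of-suc {1} {w} b<2 refl
wt-digit (suc (suc _)) _       (s≤s (s≤s ()))

bits : ℕ → (ℕ → ℕ) → ℕ
bits N b = ∑[ k < N ] (b k * 2 ^ k)

bits-suc : ∀ N (b : ℕ → ℕ) → bits (suc N) b ≡ b 0 + bits N (λ k → b (suc k)) * 2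
bits-suc N b = cong₂ _+_ (*-identityʳ (b 0)) (begin
  ∑[ k < N ] (b (suc k) * (2 * 2 ^ k)) ≡⟨ ∑-cong N (λ k _ → reassoc (b (suc k)) (2 ^ k)) ⟩
  ∑[ k < N ] (b (suc k) * 2 ^ k * 2)   ≡⟨ *-distribʳ-∑ N 2 (λ k → b (suc k) * 2 ^ k) ⟨
  bits N (λ k → b (suc k)) * 2         ∎)
  where
  open ≡-Reasoning
  reassoc : ∀ x y → x * (2 * y) ≡ x * y * 2
  reassoc = solve-∀

wt-bits : ∀ N (b : ℕ → ℕ) → (∀ k → k < N → b k < 2) → wt (bits N b) ≡ ∑ N b
wt-bits zero    b digits = refl
wt-bits (suc N) b digits = begin
  wt (bits (suc N) b)                          ≡⟨ cong wt (bits-suc N b) ⟩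
  wt (b 0 + bits N (λ k → b (suc k)) * 2)      ≡⟨ wt-digit (b 0) (bits N (λ k → b (suc k))) (digits 0 z<s) ⟩
  b 0 + wt (bits N (λ k → b (suc k)))          ≡⟨ cong (b 0 +_) (wt-bits N _ (λ k k<N → digits (suc k) (s≤s k<N))) ⟩
  ∑ (suc N) b                                  ∎
  where open ≡-Reasoning

bits<2^N : ∀ N (b : ℕ → ℕ) → (∀ k → k < N → b k < 2) → bits N b < 2 ^ N
bits<2^N zero    b digits = s≤s z≤n
bits<2^N (suc N) b digits = begin-strict
  bits (suc N) b                     ≡⟨ bits-suc N b ⟩
  b 0 + bits N (λ k → b (suc k)) * 2 <⟨ +-monoˡ-< _ (digits 0 z<s) ⟩
  2 + bits N (λ k → b (suc k)) * 2   ≡⟨ *-comm (suc (bits N (λ k → b (suc k)))) 2 ⟩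
  2 * suc (bits N (λ k → b (suc k))) ≤⟨ *-monoʳ-≤ 2 (bits<2^N N _ (λ k k<N → digits (suc k) (s≤s k<N))) ⟩
  2 * 2 ^ N                          ∎
  where open ≤-Reasoning

∑-2^+1 : ∀ N → (∑[ k < N ] (2 ^ k)) + 1 ≡ 2 ^ N
∑-2^+1 zero    = refl
∑-2^+1 (suc N) = begin
  1 + ∑[ k < N ] (2 * 2 ^ k) + 1 ≡⟨ cong (λ x → 1 + x + 1) (*-distribˡ-∑ N 2 (2 ^_)) ⟨
  1 + 2 * (∑[ k < N ] (2 ^ k)) + 1   ≡⟨ regroup (∑ N (2 ^_)) ⟩
  2 * ((∑[ k < N ] (2 ^ k)) + 1)     ≡⟨ cong (2 *_) (∑-2^+1 N) ⟩
  2 * 2 ^ N                      ∎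
  where
  open ≡-Reasoning
  regroup : ∀ x → 1 + 2 * x + 1 ≡ 2 * (x + 1)
  regroup = solve-∀

wt[2^N∸1]≡N : ∀ N → wt (2 ^ N ∸ 1) ≡ N
wt[2^N∸1]≡N N = begin
  wt (2 ^ N ∸ 1)                   ≡⟨ cong (λ x → wt (x ∸ 1)) (∑-2^+1 N) ⟨
  wt ((∑[ k < N ] (2 ^ k)) + 1 ∸ 1)    ≡⟨ cong wt (m+n∸n≡m (∑ N (2 ^_)) 1) ⟩
  wt (∑[ k < N ] (2 ^ k))            ≡⟨ cong wt (∑-cong N (λ k _ → sym (*-identityˡ (2 ^ k)))) ⟩
  wt (bits N (λ _ → 1))            ≡⟨ wt-bits N (λ _ → 1) (λ _ _ → s≤s (s≤s z≤n)) ⟩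
  ∑[ _ < N ] 1                     ≡⟨ ∑-const N 1 ⟩
  N * 1                            ≡⟨ *-identityʳ N ⟩
  N                                ∎
  where open ≡-Reasoning

0<m*n⇒0<n : ∀ m {n} → 0 < m * n → 0 < n
0<m*n⇒0<n m {zero}  p = ⊥-elim (<-irrefl (sym (*-zeroʳ m)) p)
0<m*n⇒0<n m {suc n} _ = z<s

module DistinctPowersOfTwo (d m N : ℕ) (a e : ℕ → ℕ → ℕ)
  (e<N : ∀ i j → e i j < N)
  (e-injective : ∀ {i i′ j j′} → i < d → i′ < d → j < m → j′ < m →
                 e i j ≡ e i′ j′ → i ≡ i′ × j ≡ j′) where

  digit : ℕ → ℕ
  digit k = ∑[ i < d ] ∑[ j < m ] (a i j * δ (e i j) k)

  ∑∑-2^e≡bits : ∑[ i < d ] ∑[ j < m ] (a i j * 2 ^ e i j) ≡ bits N digit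
  ∑∑-2^e≡bits = begin
    ∑[ i < d ] ∑[ j < m ] (a i j * 2 ^ e i j)                   ≡⟨ ∑-cong d (λ i _ → ∑-cong m (λ j _ → cell i j)) ⟩
    ∑[ i < d ] ∑[ j < m ] ∑[ k < N ] (a i j * δ (e i j) k * 2 ^ k) ≡⟨ ∑-cong d (λ i _ → ∑-comm m N _) ⟩
    ∑[ i < d ] ∑[ k < N ] ∑[ j < m ] (a i j * δ (e i j) k * 2 ^ k) ≡⟨ ∑-comm d N _ ⟩
    ∑[ k < N ] ∑[ i < d ] ∑[ j < m ] (a i j * δ (e i j) k * 2 ^ k) ≡⟨ ∑-cong N (λ k _ → factor k) ⟨
    bits N digit                                                 ∎
    where
    open ≡-Reasoning
    cell : ∀ i j → a i j * 2 ^ e i j ≡ ∑[ k < N ] (a i j * δ (e i j) k * 2 ^ k)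
    cell i j = begin
      a i j * 2 ^ e i j                        ≡⟨ cong (a i j *_) (∑-δ N (e i j) (2 ^_) (e<N i j)) ⟨
      a i j * ∑[ k < N ] (δ (e i j) k * 2 ^ k) ≡⟨ *-distribˡ-∑ N (a i j) _ ⟩
      ∑[ k < N ] (a i j * (δ (e i j) k * 2 ^ k)) ≡⟨ ∑-cong N (λ k _ → sym (*-assoc (a i j) _ _)) ⟩
      ∑[ k < N ] (a i j * δ (e i j) k * 2 ^ k) ∎
    factor : ∀ k → digit k * 2 ^ k ≡ ∑[ i < d ] ∑[ j < m ] (a i j * δ (e i j) k * 2 ^ k)
    factor k = trans (*-distribʳ-∑ d (2 ^ k) _) (∑-cong d (λ i _ → *-distribʳ-∑ m (2 ^ k) _))

  ∑-digit : ∑ N digit ≡ ∑[ i < d ] ∑[ j < m ] a i j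
  ∑-digit = begin
    ∑[ k < N ] ∑[ i < d ] ∑[ j < m ] (a i j * δ (e i j) k) ≡⟨ ∑-comm d N _ ⟨
    ∑[ i < d ] ∑[ k < N ] ∑[ j < m ] (a i j * δ (e i j) k) ≡⟨ ∑-cong d (λ i _ → ∑-comm m N _) ⟨
    ∑[ i < d ] ∑[ j < m ] ∑[ k < N ] (a i j * δ (e i j) k) ≡⟨ ∑-cong d (λ i _ → ∑-cong m (λ j _ → cell i j)) ⟩
    ∑[ i < d ] ∑[ j < m ] a i j                             ∎
    where
    open ≡-Reasoning
    cell : ∀ i j → ∑[ k < N ] (a i j * δ (e i j) k) ≡ a i j
    cell i j = begin
      ∑[ k < N ] (a i j * δ (e i j) k)     ≡⟨ *-distribˡ-∑ N (a i j) _ ⟨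
      a i j * ∑[ k < N ] δ (e i j) k       ≡⟨ cong (a i j *_) (∑-cong N (λ k _ → sym (*-identityʳ _))) ⟩
      a i j * ∑[ k < N ] (δ (e i j) k * 1) ≡⟨ cong (a i j *_) (∑-δ N (e i j) (λ _ → 1) (e<N i j)) ⟩
      a i j * 1                            ≡⟨ *-identityʳ (a i j) ⟩
      a i j                                ∎

  digit<2 : (∀ i j → a i j < 2) → ∀ k → digit k < 2
  digit<2 a<2 k = s≤s (∑-≤1 d _ row≤1 λ i i′ i<d i′<d p p′ →
    let j  , j<m  , q  = ∑-positive m _ p
        j′ , j′<m , q′ = ∑-positive m _ p′
    in proj₁ (e-injective i<d i′<d j<m j′<m (trans (hit i j q) (sym (hit i′ j′ q′)))))
    where
    hit : ∀ i j → 0 < a i j * δ (e i j) k → e i j ≡ k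
    hit i j p = δ-positive⇒≡ (e i j) k (0<m*n⇒0<n (a i j) p)
    row≤1 : ∀ i → i < d → ∑[ j < m ] (a i j * δ (e i j) k) ≤ 1
    row≤1 i i<d = ∑-≤1 m _ (λ j _ → *-mono-≤ (s≤s⁻¹ (a<2 i j)) (δ≤1 (e i j) k)) λ j j′ j<m j′<m p p′ →
      proj₂ (e-injective i<d i<d j<m j′<m (trans (hit i j p) (sym (hit i j′ p′))))

evenBit : ℕ → ℕ
evenBit zero          = 1
evenBit (suc zero)    = 0
evenBit (suc (suc j)) = evenBit j

rowA : ℕ → ℕ
rowA zero          = 0
rowA (suc zero)    = 0
rowA (suc (suc j)) = evenBit j

rowB : ℕ → ℕ
rowB zero          = 1
rowB (suc zero)    = 1
rowB (suc (suc j)) = evenBit (suc j)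

evenBit<2 : ∀ j → evenBit j < 2
evenBit<2 zero          = s≤s (s≤s z≤n)
evenBit<2 (suc zero)    = s≤s z≤n
evenBit<2 (suc (suc j)) = evenBit<2 j

evenBit-+-evenBit-suc : ∀ j → evenBit j + evenBit (suc j) ≡ 1
evenBit-+-evenBit-suc zero          = refl
evenBit-+-evenBit-suc (suc zero)    = refl
evenBit-+-evenBit-suc (suc (suc j)) = evenBit-+-evenBit-suc j

evenBit[q+q]≡1 : ∀ q → evenBit (q + q) ≡ 1
evenBit[q+q]≡1 zero    = refl
evenBit[q+q]≡1 (suc q) = trans (cong (λ x → evenBit (suc x)) (+-suc q q)) (evenBit[q+q]≡1 q)

rowA-pair : ∀ j → rowA (suc j) + rowA (suc (suc j)) ≡ 1
rowA-pair zero    = refl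
rowA-pair (suc j) = evenBit-+-evenBit-suc j

rowB-pair : ∀ j → rowB (suc j) + rowB (suc (suc j)) ≡ 1
rowB-pair zero    = refl
rowB-pair (suc j) = trans (+-comm (evenBit (suc j)) (evenBit j)) (evenBit-+-evenBit-suc j)

∑-evenBit : ∀ q → ∑ (suc (q + q)) evenBit ≡ suc q
∑-evenBit zero    = refl
∑-evenBit (suc q) = trans (cong (λ x → ∑ (suc (suc x)) evenBit) (+-suc q q)) (cong suc (∑-evenBit q))

∑-evenBit∘suc : ∀ q → ∑[ j < suc (q + q) ] evenBit (suc j) ≡ q
∑-evenBit∘suc zero    = refl
∑-evenBit∘suc (suc q) =
  trans (cong (λ x → ∑[ j < suc (suc x) ] evenBit (suc j)) (+-suc q q)) (cong suc (∑-evenBit∘suc q))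

∑-rowA : ∀ q → ∑ (suc (q + q)) rowA ≡ q
∑-rowA zero    = refl
∑-rowA (suc q) = trans (cong (λ x → ∑ (suc (suc x)) rowA) (+-suc q q)) (∑-evenBit q)

∑-rowB : ∀ q → ∑ (suc (q + q)) rowB ≡ suc q
∑-rowB zero    = refl
∑-rowB (suc q) = trans (cong (λ x → ∑ (suc (suc x)) rowB) (+-suc q q)) (cong (2 +_) (∑-evenBit∘suc q))

isEven-indicator : ∀ j → (if isEven j then 1 else 0) ≡ evenBit j
isEven-indicator zero          = refl
isEven-indicator (suc zero)    = refl
isEven-indicator (suc (suc j)) = isEven-indicator j

isOdd-indicator : ∀ j → (if isEven j then 0 else 1) ≡ evenBit (suc j)
isOdd-indicator zero          = refl
isOdd-indicator (suc zero)    = refl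
isOdd-indicator (suc (suc j)) = isOdd-indicator j

entry≡rowA : ∀ d i j → i ≢ d ∸ 1 → entry d i j ≡ rowA j
entry≡rowA d i j i≢d-1 with i ≡ᵇ (d ∸ 1) in eq
... | true = ⊥-elim (i≢d-1 (≡ᵇ⇒≡ i (d ∸ 1) (subst T (sym eq) tt)))
entry≡rowA d i zero          _ | false = refl
entry≡rowA d i (suc zero)    _ | false = refl
entry≡rowA d i (suc (suc j)) _ | false = isEven-indicator j

entry≡rowB : ∀ d j → entry d (d ∸ 1) j ≡ rowB j
entry≡rowB d j with (d ∸ 1) ≡ᵇ (d ∸ 1) in eq
... | false = ⊥-elim (subst T eq (≡⇒≡ᵇ (d ∸ 1) (d ∸ 1) refl))
entry≡rowB d zero          | true = refl
entry≡rowB d (suc zero)    | true = refl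
entry≡rowB d (suc (suc j)) | true = isOdd-indicator j

entry<2 : ∀ d i j → entry d i j < 2
entry<2 d i j with i ≟ d ∸ 1
... | yes refl  = subst (_< 2) (sym (entry≡rowB d j)) (rowB<2 j)
  where
  rowB<2 : ∀ j → rowB j < 2
  rowB<2 zero          = s≤s (s≤s z≤n)
  rowB<2 (suc zero)    = s≤s (s≤s z≤n)
  rowB<2 (suc (suc j)) = evenBit<2 (suc j)
... | no  i≢d-1 = subst (_< 2) (sym (entry≡rowA d i j i≢d-1)) (rowA<2 j)
  where
  rowA<2 : ∀ j → rowA j < 2
  rowA<2 zero          = s≤s z≤n
  rowA<2 (suc zero)    = s≤s z≤n
  rowA<2 (suc (suc j)) = evenBit<2 j

module _ {M : ℕ} (c : ℕ) (E : ℕ → ℕ) (k : ℕ)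
  (wrap : c * E 0 ≈ E k [mod M ]) (shift : ∀ j → j < k → c * E (suc j) ≈ E j [mod M ]) where

  *-∑-cyclic-shift : ∀ (a : ℕ → ℕ) →
    c * ∑[ j < suc k ] (a j * E j) ≈ a 0 * E k + ∑[ j < k ] (a (suc j) * E j) [mod M ]
  *-∑-cyclic-shift a = begin
    c * ∑[ j < suc k ] (a j * E j)                                ≡⟨ *-distribˡ-+ c (a 0 * E 0) _ ⟩
    c * (a 0 * E 0) + c * ∑[ j < k ] (a (suc j) * E (suc j))      ≡⟨ cong (c * (a 0 * E 0) +_) (*-distribˡ-∑ k c _) ⟩
    c * (a 0 * E 0) + ∑[ j < k ] (c * (a (suc j) * E (suc j)))    ≈⟨ ≈-+ (move (a 0) (E 0) (E k) wrap)
                                                                         (≈-∑ k λ j j<k → move (a (suc j)) _ _ (shift j j<k)) ⟩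
    a 0 * E k + ∑[ j < k ] (a (suc j) * E j)                      ∎
    where
    open ≈-Reasoning M
    move : ∀ x y z → c * y ≈ z [mod M ] → c * (x * y) ≈ x * z [mod M ]
    move x y z cy≈z = ≈-trans (≈-reflexive (x*y*z-comm c x y)) (≈-*ˡ x cy≈z)
      where
      x*y*z-comm : ∀ c x y → c * (x * y) ≡ x * (c * y)
      x*y*z-comm = solve-∀

  [c+1]*∑-cyclic : ∀ (a : ℕ → ℕ) →
    (c + 1) * ∑[ j < suc k ] (a j * E j) ≈ ∑[ j < k ] ((a j + a (suc j)) * E j) + (a k + a 0) * E k [mod M ]
  [c+1]*∑-cyclic a = begin
    (c + 1) * X                          ≡⟨ trans (*-distribʳ-+ X c 1) (cong (c * X +_) (*-identityˡ X)) ⟩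
    c * X + X                            ≈⟨ ≈-+ (*-∑-cyclic-shift a) (≈-reflexive (∑-snoc k (λ j → a j * E j))) ⟩
    (a 0 * E k + P) + (Q + a k * E k)    ≡⟨ regroup (a 0) (E k) P Q (a k) ⟩
    (Q + P) + (a k + a 0) * E k          ≡⟨ cong (_+ (a k + a 0) * E k) (sym (∑-distrib-+ k _ _)) ⟩
    ∑[ j < k ] (a j * E j + a (suc j) * E j) + (a k + a 0) * E k
                                         ≡⟨ cong (_+ (a k + a 0) * E k) (∑-cong k (λ j _ → sym (*-distribʳ-+ (E j) (a j) _))) ⟩
    ∑[ j < k ] ((a j + a (suc j)) * E j) + (a k + a 0) * E k ∎
    where
    open ≈-Reasoning M
    X = ∑[ j < suc k ] (a j * E j)
    P = ∑[ j < k ] (a (suc j) * E j)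
    Q = ∑[ j < k ] (a j * E j)
    regroup : ∀ a₀ e P Q aₖ → (a₀ * e + P) + (Q + aₖ * e) ≡ (Q + P) + (aₖ + a₀) * e
    regroup = solve-∀

rowA-differences : ∀ (E : ℕ → ℕ) q →
  ∑[ j < q + q ] ((rowA j + rowA (suc j)) * E j) + (rowA (q + q) + rowA 0) * E (q + q) + E 0 ≡ ∑ (suc (q + q)) E
rowA-differences E zero    = sym (+-identityʳ (E 0))
rowA-differences E (suc q) rewrite +-suc q q = begin
  0 + ∑[ j < suc (q + q) ] ((rowA (suc j) + rowA (suc (suc j))) * E (suc j))
    + (evenBit (q + q) + 0) * E (suc (suc (q + q))) + E 0
      ≡⟨ cong₂ (λ x y → 0 + x + (y + 0) * E (suc (suc (q + q))) + E 0)
               (∑-cong (suc (q + q)) (λ j _ → trans (cong (_* E (suc j)) (rowA-pair j)) (*-identityˡ _)))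
               (evenBit[q+q]≡1 q) ⟩
  ∑[ j < suc (q + q) ] E (suc j) + 1 * E (suc (suc (q + q))) + E 0
      ≡⟨ regroup (∑[ j < suc (q + q) ] E (suc j)) (E (suc (suc (q + q)))) (E 0) ⟩
  E 0 + (∑[ j < suc (q + q) ] E (suc j) + E (suc (suc (q + q))))
      ≡⟨ cong (E 0 +_) (∑-snoc (suc (q + q)) (λ j → E (suc j))) ⟨
  ∑ (suc (suc (suc (q + q)))) E ∎
  where
  open ≡-Reasoning
  regroup : ∀ x y z → x + 1 * y + z ≡ z + (x + y)
  regroup = solve-∀

rowB-differences : ∀ (E : ℕ → ℕ) q →
  ∑[ j < q + q ] ((rowB j + rowB (suc j)) * E j) + (rowB (q + q) + rowB 0) * E (q + q) ≡ ∑ (suc (q + q)) E + E 0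
rowB-differences E zero    = regroup (E 0)
  where
  regroup : ∀ x → 0 + 2 * x ≡ x + 0 + x
  regroup = solve-∀
rowB-differences E (suc q) rewrite +-suc q q = begin
  2 * E 0 + ∑[ j < suc (q + q) ] ((rowB (suc j) + rowB (suc (suc j))) * E (suc j))
    + (evenBit (suc (q + q)) + 1) * E (suc (suc (q + q)))
      ≡⟨ cong₂ (λ x y → 2 * E 0 + x + (y + 1) * E (suc (suc (q + q))))
               (∑-cong (suc (q + q)) (λ j _ → trans (cong (_* E (suc j)) (rowB-pair j)) (*-identityˡ _)))
               evenBit[1+q+q]≡0 ⟩
  2 * E 0 + ∑[ j < suc (q + q) ] E (suc j) + 1 * E (suc (suc (q + q)))
      ≡⟨ regroup (∑[ j < suc (q + q) ] E (suc j)) (E (suc (suc (q + q)))) (E 0) ⟩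
  E 0 + (∑[ j < suc (q + q) ] E (suc j) + E (suc (suc (q + q)))) + E 0
      ≡⟨ cong (λ x → E 0 + x + E 0) (∑-snoc (suc (q + q)) (λ j → E (suc j))) ⟨
  ∑ (suc (suc (suc (q + q)))) E + E 0 ∎
  where
  open ≡-Reasoning
  regroup : ∀ x y z → 2 * z + x + 1 * y ≡ z + (x + y) + z
  regroup = solve-∀
  evenBit[1+q+q]≡0 : evenBit (suc (q + q)) ≡ 0
  evenBit[1+q+q]≡0 = +-cancelˡ-≡ 1 _ _ (trans (cong (_+ evenBit (suc (q + q))) (sym (evenBit[q+q]≡1 q)))
                                               (evenBit-+-evenBit-suc (q + q)))

%≡%⇒∣∸ : ∀ a b N .{{_ : NonZero N}} → a % N ≡ b % N → N ∣ b ∸ a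
%≡%⇒∣∸ a b N eq = divides (b / N ∸ a / N) (begin
  b ∸ a                                   ≡⟨ cong₂ _∸_ (m≡m%n+[m/n]*n b N) (m≡m%n+[m/n]*n a N) ⟩
  (b % N + b / N * N) ∸ (a % N + a / N * N) ≡⟨ cong (λ z → (b % N + b / N * N) ∸ (z + a / N * N)) eq ⟩
  (b % N + b / N * N) ∸ (b % N + a / N * N) ≡⟨ [m+n]∸[m+o]≡n∸o (b % N) _ _ ⟩
  b / N * N ∸ a / N * N                   ≡⟨ *-distribʳ-∸ N (b / N) (a / N) ⟨
  (b / N ∸ a / N) * N                     ∎)
  where open ≡-Reasoning

small-multiple : ∀ {m t} → m ∣ t → t < m → t ≡ 0
small-multiple {t = zero}  _   _   = refl
small-multiple {t = suc t} m∣t t<m = ⊥-elim (<⇒≱ t<m (∣⇒≤ m∣t))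

module Inverse (n′ r d′ q : ℕ) (isGCD : GCD r (suc n′) (suc d′))
  (n≡m*d : suc n′ ≡ suc (q + q) * suc d′) where

  n d m k : ℕ
  n = suc n′
  d = suc d′
  m = suc k
  k = q + q

  r′ : ℕ
  r′ = quotient (GCD.gcd∣m isGCD)

  r≡r′*d : r ≡ r′ * d
  r≡r′*d = m∣n⇒n≡quotient*m (GCD.gcd∣m isGCD)

  coprime : Coprime m r′
  coprime = Coprimality.sym (GCD≡1⇒coprime (GCD-* (subst (GCD _ _) (sym (*-identityˡ d))
    (subst₂ (λ a b → GCD a b d) r≡r′*d n≡m*d isGCD))))

  -- pow i j ≈ 2^(i - j r) modulo 2^n - 1, because n′ = n - 1 ≡ -1 (mod n).
  pow : ℕ → ℕ → ℕ
  pow i j = 2 ^ (i + j * r * n′)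

  pow-shift : ∀ i j → 2 ^ r * pow i (suc j) ≈ pow i j [mod 2 ^ n ∸ 1 ]
  pow-shift i j = ≈-trans (≈-reflexive (trans (sym (^-distribˡ-+-* 2 r _)) (cong (2 ^_) (regroup r i j n′))))
                          (2^[x+qn]≈2^x n (i + j * r * n′) r)
    where
    regroup : ∀ r i j n′ → r + (i + (1 + j) * r * n′) ≡ (i + j * r * n′) + r * (1 + n′)
    regroup = solve-∀

  -- m r = r′ n, so the exponents of a row are periodic in j with period m.
  pow-wrap : ∀ i → 2 ^ r * pow i 0 ≈ pow i k [mod 2 ^ n ∸ 1 ]
  pow-wrap i = begin
    2 ^ r * pow i 0              ≡⟨ ^-distribˡ-+-* 2 r (i + 0) ⟨
    2 ^ (r + (i + 0))            ≈⟨ 2^[x+qn]≈2^x n (r + (i + 0)) (k * r) ⟨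
    2 ^ (r + (i + 0) + k * r * n) ≡⟨ cong (2 ^_) exponents ⟩
    2 ^ (i + k * r * n′ + r′ * n) ≈⟨ 2^[x+qn]≈2^x n (i + k * r * n′) r′ ⟩
    pow i k                      ∎
    where
    open ≈-Reasoning (2 ^ n ∸ 1)
    regroup : ∀ i k r n′ → r + (i + 0) + k * r * (1 + n′) ≡ i + k * r * n′ + (1 + k) * r
    regroup = solve-∀
    r′n≡mr : r′ * n ≡ m * r
    r′n≡mr = trans (cong (r′ *_) n≡m*d) (trans (x*[y*z]≡y*[x*z] r′ m d) (cong (m *_) (sym r≡r′*d)))
      where
      x*[y*z]≡y*[x*z] : ∀ x y z → x * (y * z) ≡ y * (x * z)
      x*[y*z]≡y*[x*z] = solve-∀
    exponents : r + (i + 0) + k * r * n ≡ i + k * r * n′ + r′ * n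
    exponents = trans (regroup i k r n′) (cong (i + k * r * n′ +_) (sym r′n≡mr))

  Y : ℕ
  Y = ∑ m (pow 0)

  2^r*Y≈Y : 2 ^ r * Y ≈ Y [mod 2 ^ n ∸ 1 ]
  2^r*Y≈Y = begin
    2 ^ r * ∑ m (pow 0)
      ≡⟨ cong (2 ^ r *_) (∑-cong m (λ j _ → sym (*-identityˡ (pow 0 j)))) ⟩
    2 ^ r * ∑[ j < m ] (1 * pow 0 j)
      ≈⟨ *-∑-cyclic-shift (2 ^ r) (pow 0) k (pow-wrap 0) (λ j _ → pow-shift 0 j) (λ _ → 1) ⟩
    1 * pow 0 k + ∑[ j < k ] (1 * pow 0 j)
      ≡⟨ cong₂ _+_ (*-identityˡ (pow 0 k)) (∑-cong k (λ j _ → *-identityˡ (pow 0 j))) ⟩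
    pow 0 k + ∑ k (pow 0)
      ≡⟨ trans (+-comm (pow 0 k) _) (sym (∑-snoc k (pow 0))) ⟩
    Y ∎
    where open ≈-Reasoning (2 ^ n ∸ 1)

  2^[x*r]*Y≈Y : ∀ x → 2 ^ (x * r) * Y ≈ Y [mod 2 ^ n ∸ 1 ]
  2^[x*r]*Y≈Y zero    = ≈-reflexive (*-identityˡ Y)
  2^[x*r]*Y≈Y (suc x) = begin
    2 ^ (r + x * r) * Y       ≡⟨ trans (cong (_* Y) (^-distribˡ-+-* 2 r (x * r))) (*-assoc (2 ^ r) _ Y) ⟩
    2 ^ r * (2 ^ (x * r) * Y) ≈⟨ ≈-*ˡ (2 ^ r) (2^[x*r]*Y≈Y x) ⟩
    2 ^ r * Y                 ≈⟨ 2^r*Y≈Y ⟩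
    Y                         ∎
    where open ≈-Reasoning (2 ^ n ∸ 1)

  2^d*Y≈Y : 2 ^ d * Y ≈ Y [mod 2 ^ n ∸ 1 ]
  2^d*Y≈Y = from-identity (Bézout.identity isGCD)
    where
    open ≈-Reasoning (2 ^ n ∸ 1)
    from-identity : Bézout.Identity d r n → 2 ^ d * Y ≈ Y [mod 2 ^ n ∸ 1 ]
    from-identity (Bézout.+- x y d+yn≡xr) = begin
      2 ^ d * Y            ≈⟨ ≈-*ʳ Y (2^[x+qn]≈2^x n d y) ⟨
      2 ^ (d + y * n) * Y  ≡⟨ cong (λ e → 2 ^ e * Y) d+yn≡xr ⟩
      2 ^ (x * r) * Y      ≈⟨ 2^[x*r]*Y≈Y x ⟩
      Y                    ∎
    from-identity (Bézout.-+ x y d+xr≡yn) = begin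
      2 ^ d * Y                 ≈⟨ ≈-*ˡ (2 ^ d) (2^[x*r]*Y≈Y x) ⟨
      2 ^ d * (2 ^ (x * r) * Y) ≡⟨ *-assoc (2 ^ d) _ Y ⟨
      2 ^ d * 2 ^ (x * r) * Y   ≡⟨ cong (_* Y) (trans (sym (^-distribˡ-+-* 2 d (x * r))) (cong (2 ^_) d+xr≡yn)) ⟩
      2 ^ (0 + y * n) * Y       ≈⟨ ≈-*ʳ Y (2^[x+qn]≈2^x n 0 y) ⟩
      1 * Y                     ≡⟨ *-identityˡ Y ⟩
      Y                         ∎

  ∑∑-pow≈0 : ∑[ i < d ] ∑ m (pow i) ≈ 0 [mod 2 ^ n ∸ 1 ]
  ∑∑-pow≈0 = ≈-+-cancelʳ Y (begin
    ∑[ i < d ] ∑ m (pow i) + Y            ≡⟨ cong (_+ Y) (∑-cong d (λ i _ → row i)) ⟩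
    ∑[ i < d ] (2 ^ i * Y) + Y            ≡⟨ cong (_+ Y) (*-distribʳ-∑ d Y (2 ^_)) ⟨
    ∑ d (2 ^_) * Y + Y                    ≡⟨ factor (∑ d (2 ^_)) Y ⟩
    (∑ d (2 ^_) + 1) * Y                  ≡⟨ cong (_* Y) (∑-2^+1 d) ⟩
    2 ^ d * Y                             ≈⟨ 2^d*Y≈Y ⟩
    0 + Y                                 ∎)
    where
    open ≈-Reasoning (2 ^ n ∸ 1)
    row : ∀ i → ∑ m (pow i) ≡ 2 ^ i * Y
    row i = trans (∑-cong m (λ j _ → ^-distribˡ-+-* 2 i (j * r * n′))) (sym (*-distribˡ-∑ m (2 ^ i) (pow 0)))
    factor : ∀ P Y → P * Y + Y ≡ (P + 1) * Y
    factor = solve-∀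

  rowSum : ℕ → ℕ
  rowSum i = ∑[ j < m ] (entry d i j * pow i j)

  G*rowSum-A : ∀ i → i < d′ → G r * rowSum i + pow i 0 ≈ ∑ m (pow i) [mod 2 ^ n ∸ 1 ]
  G*rowSum-A i i<d′ = begin
    G r * rowSum i + pow i 0
      ≡⟨ cong (λ x → G r * x + pow i 0) (∑-cong m (λ j _ → cong (_* pow i j) (entry≡rowA d i j (<⇒≢ i<d′)))) ⟩
    G r * ∑[ j < m ] (rowA j * pow i j) + pow i 0
      ≈⟨ ≈-+ ([c+1]*∑-cyclic (2 ^ r) (pow i) k (pow-wrap i) (λ j _ → pow-shift i j) rowA) ≈-refl ⟩
    ∑[ j < k ] ((rowA j + rowA (suc j)) * pow i j) + (rowA k + rowA 0) * pow i k + pow i 0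
      ≡⟨ rowA-differences (pow i) q ⟩
    ∑ m (pow i) ∎
    where open ≈-Reasoning (2 ^ n ∸ 1)

  G*rowSum-B : G r * rowSum d′ ≈ ∑ m (pow d′) + pow d′ 0 [mod 2 ^ n ∸ 1 ]
  G*rowSum-B = begin
    G r * rowSum d′
      ≡⟨ cong (G r *_) (∑-cong m (λ j _ → cong (_* pow d′ j) (entry≡rowB d j))) ⟩
    G r * ∑[ j < m ] (rowB j * pow d′ j)
      ≈⟨ [c+1]*∑-cyclic (2 ^ r) (pow d′) k (pow-wrap d′) (λ j _ → pow-shift d′ j) rowB ⟩
    ∑[ j < k ] ((rowB j + rowB (suc j)) * pow d′ j) + (rowB k + rowB 0) * pow d′ k
      ≡⟨ rowB-differences (pow d′) q ⟩
    ∑ m (pow d′) + pow d′ 0 ∎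
    where open ≈-Reasoning (2 ^ n ∸ 1)

  G*∑rowSum-by-rows : G r * ∑ d rowSum + ∑ d′ (2 ^_) ≡ ∑[ i < d′ ] (G r * rowSum i + pow i 0) + G r * rowSum d′
  G*∑rowSum-by-rows = begin
    G r * ∑ d rowSum + ∑ d′ (2 ^_)
      ≡⟨ cong (λ x → G r * x + ∑ d′ (2 ^_)) (∑-snoc d′ rowSum) ⟩
    G r * (∑ d′ rowSum + rowSum d′) + ∑ d′ (2 ^_)
      ≡⟨ regroup (G r) _ _ _ ⟩
    (G r * ∑ d′ rowSum + ∑ d′ (2 ^_)) + G r * rowSum d′
      ≡⟨ cong₂ (λ x y → x + y + G r * rowSum d′) (*-distribˡ-∑ d′ (G r) rowSum)
               (∑-cong d′ (λ i _ → cong (2 ^_) (sym (+-identityʳ i)))) ⟩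
    ∑[ i < d′ ] (G r * rowSum i) + ∑[ i < d′ ] pow i 0 + G r * rowSum d′
      ≡⟨ cong (_+ G r * rowSum d′) (sym (∑-distrib-+ d′ _ _)) ⟩
    ∑[ i < d′ ] (G r * rowSum i + pow i 0) + G r * rowSum d′ ∎
    where
    open ≡-Reasoning
    regroup : ∀ g x y p → g * (x + y) + p ≡ (g * x + p) + g * y
    regroup = solve-∀

  G*∑rowSum≈1 : G r * ∑ d rowSum ≈ 1 [mod 2 ^ n ∸ 1 ]
  G*∑rowSum≈1 = ≈-+-cancelʳ (∑ d′ (2 ^_)) (begin
    G r * ∑ d rowSum + ∑ d′ (2 ^_)
      ≡⟨ G*∑rowSum-by-rows ⟩
    ∑[ i < d′ ] (G r * rowSum i + pow i 0) + G r * rowSum d′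
      ≈⟨ ≈-+ (≈-∑ d′ G*rowSum-A) G*rowSum-B ⟩
    ∑[ i < d′ ] ∑ m (pow i) + (∑ m (pow d′) + pow d′ 0)
      ≡⟨ +-assoc (∑[ i < d′ ] ∑ m (pow i)) (∑ m (pow d′)) (pow d′ 0) ⟨
    ∑[ i < d′ ] ∑ m (pow i) + ∑ m (pow d′) + pow d′ 0
      ≡⟨ cong (_+ pow d′ 0) (∑-snoc d′ (λ i → ∑ m (pow i))) ⟨
    ∑[ i < d ] ∑ m (pow i) + pow d′ 0
      ≈⟨ ≈-+ ∑∑-pow≈0 ≈-refl ⟩
    pow d′ 0
      ≡⟨ trans (cong (2 ^_) (+-identityʳ d′)) (trans (sym (∑-2^+1 d′)) (+-comm _ 1)) ⟩
    1 + ∑ d′ (2 ^_) ∎)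
    where
    open ≈-Reasoning (2 ^ n ∸ 1)

  S≡∑∑ : S n r d m ≡ ∑[ i < d ] ∑[ j < m ] (entry d i j * 2 ^ expo n r i j)
  S≡∑∑ = trans (sum-map-upTo (λ i → sum (map (λ j → entry d i j * 2 ^ expo n r i j) (upTo m))) d)
               (∑-cong d (λ i _ → sum-map-upTo (λ j → entry d i j * 2 ^ expo n r i j) m))

  S≈∑rowSum : S n r d m ≈ ∑ d rowSum [mod 2 ^ n ∸ 1 ]
  S≈∑rowSum = ≈-trans (≈-reflexive S≡∑∑) (≈-∑ d λ i _ → ≈-∑ m λ j _ →
    ≈-*ˡ (entry d i j) (≈-sym (2^x≈2^[x%n] n (i + j * r * n′))))

  G*S≈1 : G r * S n r d m ≈ 1 [mod 2 ^ n ∸ 1 ]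
  G*S≈1 = ≈-trans (≈-*ˡ (G r) S≈∑rowSum) G*∑rowSum≈1

  expo<n : ∀ i j → expo n r i j < n
  expo<n i j = m%n<n (i + j * r * n′) n

  expo%d≡i : ∀ {i} j → i < d → expo n r i j % d ≡ i
  expo%d≡i {i} j i<d = begin
    x % n % d              ≡⟨ %-remove-+ʳ (x % n) (divides (x / n * m) quotient-term) ⟨
    (x % n + x / n * n) % d ≡⟨ cong (_% d) (m≡m%n+[m/n]*n x n) ⟨
    x % d                  ≡⟨ %-remove-+ʳ i (divides (j * r′ * n′) multiple-term) ⟩
    i % d                  ≡⟨ m<n⇒m%n≡m i<d ⟩
    i                      ∎
    where
    open ≡-Reasoning
    x = i + j * r * n′
    quotient-term : x / n * n ≡ x / n * m * d
    quotient-term = trans (cong (x / n *_) n≡m*d) (sym (*-assoc (x / n) m d))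
    regroup : ∀ j r′ d n′ → j * (r′ * d) * n′ ≡ j * r′ * n′ * d
    regroup = solve-∀
    multiple-term : j * r * n′ ≡ j * r′ * n′ * d
    multiple-term = trans (cong (λ z → j * z * n′) r≡r′*d) (regroup j r′ d n′)

  m∣[j′∸j] : ∀ i {j j′} → expo n r i j ≡ expo n r i j′ → m ∣ j′ ∸ j
  m∣[j′∸j] i {j} {j′} same = coprime-divisor coprime (*-cancelʳ-∣ d md∣r′td)
    where
    t = j′ ∸ j
    difference : (i + j′ * r * n′) ∸ (i + j * r * n′) ≡ t * r * n′
    difference = trans ([m+n]∸[m+o]≡n∸o i (j′ * r * n′) (j * r * n′))
      (trans (sym (*-distribʳ-∸ n′ (j′ * r) (j * r))) (cong (_* n′) (sym (*-distribʳ-∸ r j′ j))))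
    n∣trn′ : n ∣ t * r * n′
    n∣trn′ = subst (n ∣_) difference (%≡%⇒∣∸ (i + j * r * n′) (i + j′ * r * n′) n same)
    n∣trn′+tr : n ∣ t * r * n′ + t * r
    n∣trn′+tr = divides (t * r) (regroup (t * r) n′)
      where
      regroup : ∀ a n′ → a * n′ + a ≡ a * (1 + n′)
      regroup = solve-∀
    md∣r′td : m * d ∣ (r′ * t) * d
    md∣r′td = subst₂ _∣_ n≡m*d (trans (cong (t *_) r≡r′*d) (regroup t r′ d))
                (∣m+n∣m⇒∣n n∣trn′+tr n∣trn′)
      where
      regroup : ∀ t r′ d → t * (r′ * d) ≡ (r′ * t) * d
      regroup = solve-∀

  expo-injectiveʳ-≤ : ∀ i {j j′} → j ≤ j′ → j′ < m → expo n r i j ≡ expo n r i j′ → j ≡ j′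
  expo-injectiveʳ-≤ i {j} {j′} j≤j′ j′<m same = ≤-antisym j≤j′ (m∸n≡0⇒m≤n
    (small-multiple (m∣[j′∸j] i {j} {j′} same) (≤-<-trans (m∸n≤m j′ j) j′<m)))

  expo-injectiveʳ : ∀ i {j j′} → j < m → j′ < m → expo n r i j ≡ expo n r i j′ → j ≡ j′
  expo-injectiveʳ i {j} {j′} j<m j′<m same with ≤-total j j′
  ... | inj₁ j≤j′ = expo-injectiveʳ-≤ i j≤j′ j′<m same
  ... | inj₂ j′≤j = sym (expo-injectiveʳ-≤ i j′≤j j<m (sym same))

  expo-injective : ∀ {i i′ j j′} → i < d → i′ < d → j < m → j′ < m →
                   expo n r i j ≡ expo n r i′ j′ → i ≡ i′ × j ≡ j′
  expo-injective {i} {i′} {j} {j′} i<d i′<d j<m j′<m same =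
    i≡i′ , expo-injectiveʳ i′ j<m j′<m (subst (λ x → expo n r x j ≡ expo n r i′ j′) i≡i′ same)
    where
    i≡i′ : i ≡ i′
    i≡i′ = trans (sym (expo%d≡i j i<d)) (trans (cong (_% d) same) (expo%d≡i j′ i′<d))

  open DistinctPowersOfTwo d m n (entry d) (expo n r) expo<n expo-injective

  ∑∑-entry : ∑[ i < d ] ∑[ j < m ] entry d i j ≡ d′ * q + suc q
  ∑∑-entry = begin
    ∑[ i < d ] ∑[ j < m ] entry d i j                   ≡⟨ ∑-snoc d′ _ ⟩
    ∑[ i < d′ ] ∑[ j < m ] entry d i j + ∑ m (entry d d′) ≡⟨ cong₂ _+_ (∑-cong d′ rowA-count) rowB-count ⟩
    ∑[ _ < d′ ] q + suc q                               ≡⟨ cong (_+ suc q) (∑-const d′ q) ⟩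
    d′ * q + suc q                                      ∎
    where
    open ≡-Reasoning
    rowA-count : ∀ i → i < d′ → ∑ m (entry d i) ≡ q
    rowA-count i i<d′ = trans (∑-cong m (λ j _ → entry≡rowA d i j (<⇒≢ i<d′))) (∑-rowA q)
    rowB-count : ∑ m (entry d d′) ≡ suc q
    rowB-count = trans (∑-cong m (λ j _ → entry≡rowB d j)) (∑-rowB q)

  S≡bits : S n r d m ≡ bits n digit
  S≡bits = trans S≡∑∑ ∑∑-2^e≡bits

  digits : ∀ k → k < n → digit k < 2
  digits k _ = digit<2 (entry<2 d) k

  wt-S : wt (S n r d m) ≡ d′ * q + suc q
  wt-S = trans (cong wt S≡bits) (trans (wt-bits n digit digits) (trans ∑-digit ∑∑-entry))

  0<S : 0 < S n r d m
  0<S = n≢0⇒n>0 λ S≡0 → 0≢1+n (trans (cong wt (sym S≡0)) (trans wt-S (+-suc (d′ * q) q)))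

  S<2^n∸1 : 1 ≤ d′ → S n r d m < 2 ^ n ∸ 1
  S<2^n∸1 1≤d′ = ≤∧≢⇒< S≤2^n∸1 λ S≡2^n∸1 →
    <⇒≢ weight<n (trans (sym wt-S) (trans (cong wt S≡2^n∸1) (wt[2^N∸1]≡N n)))
    where
    S≤2^n∸1 : S n r d m ≤ 2 ^ n ∸ 1
    S≤2^n∸1 = subst (S n r d m ≤_) (pred[m∸n]≡m∸[1+n] (2 ^ n) 0)
      (<⇒≤pred (subst (_< 2 ^ n) (sym S≡bits) (bits<2^N n digit digits)))
    regroup : ∀ q d′ → suc (q + q) * suc d′ ≡ (d′ * q + suc q) + d′ + (q + q * d′)
    regroup = solve-∀
    weight<n : d′ * q + suc q < n
    weight<n = subst (d′ * q + suc q <_) (sym (trans n≡m*d (regroup q d′)))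
      (<-≤-trans (m<m+n _ 1≤d′) (m≤m+n _ (q + q * d′)))

  weight-formula : (n ∸ d + 2) / 2 ≡ d′ * q + suc q
  weight-formula = begin
    (n ∸ d + 2) / 2                ≡⟨ cong (λ z → (z ∸ d + 2) / 2) n≡m*d ⟩
    (d + k * d ∸ d + 2) / 2        ≡⟨ cong (λ z → (z + 2) / 2) (m+n∸m≡n d (k * d)) ⟩
    (k * d + 2) / 2                ≡⟨ cong (_/ 2) (regroup q d′) ⟩
    (d′ * q + suc q) * 2 / 2       ≡⟨ m*n/n≡m _ 2 ⟩
    d′ * q + suc q                 ∎
    where
    open ≡-Reasoning
    regroup : ∀ q d′ → (q + q) * suc d′ + 2 ≡ (d′ * q + suc q) * 2
    regroup = solve-∀

%2≡1⇒odd : ∀ {m} → m % 2 ≡ 1 → ∃ λ q → m ≡ suc (q + q)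
%2≡1⇒odd {m} m%2≡1 = m / 2 , (begin
  m                   ≡⟨ m≡m%n+[m/n]*n m 2 ⟩
  m % 2 + m / 2 * 2   ≡⟨ cong₂ _+_ m%2≡1 (*-comm (m / 2) 2) ⟩
  suc (m / 2 + (m / 2 + 0)) ≡⟨ cong (λ z → suc (m / 2 + z)) (+-identityʳ (m / 2)) ⟩
  suc (m / 2 + m / 2) ∎)
  where open ≡-Reasoning

proposition2 : (n r m : ℕ) → 0 < n → 0 < r → 1 < gcd r n →
    n ≡ m * gcd r n → m % 2 ≡ 1 →
    (∃ λ x → (0 < x) × (x < 2 ^ n ∸ 1) × (G r * x ≡ 1 [mod 2 ^ n ∸ 1 ])) ×
    ((x : ℕ) → 0 < x → x < 2 ^ n ∸ 1 → G r * x ≡ 1 [mod 2 ^ n ∸ 1 ] →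
      (x ≡ S n r (gcd r n) m [mod 2 ^ n ∸ 1 ]) × (wt x ≡ (n ∸ gcd r n + 2) / 2))
proposition2 (suc n′) r m _ _ 1<gcd n≡m*gcd m%2≡1
  with gcd r (suc n′) | gcd-GCD r (suc n′) | %2≡1⇒odd {m} m%2≡1
... | suc zero     | _     | _      = ⊥-elim (<-irrefl refl 1<gcd)
... | suc (suc d″) | isGCD | q , refl =
  (S n r d m , 0<S , S<2^n∸1 (s≤s z≤n) , ≈⇒≡[mod] G*S≈1) , unique
  where
  open Inverse n′ r (suc d″) q isGCD n≡m*gcd hiding (m)
  unique : ∀ x → 0 < x → x < 2 ^ n ∸ 1 → G r * x ≡ 1 [mod 2 ^ n ∸ 1 ] →
           (x ≡ S n r d m [mod 2 ^ n ∸ 1 ]) × (wt x ≡ (n ∸ d + 2) / 2)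
  unique x _ x<2^n∸1 Gx≡1 = ≈⇒≡[mod] x≈S , trans (cong wt x≡S) (trans wt-S (sym weight-formula))
    where
    x≈S : x ≈ S n r d m [mod 2 ^ n ∸ 1 ]
    x≈S = ≈-inverse-unique {g = G r} (≡[mod]⇒≈ Gx≡1) G*S≈1
    x≡S : x ≡ S n r d m
    x≡S = ≈-<⇒≡ x≈S x<2^n∸1 (S<2^n∸1 (s≤s z≤n))
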